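{- For every integer $n \geq 4$, $\nabla(C_{n}^{2}) \geq \left\lceil \frac{n+1}{3} \right\rceil$.
   Context: For a simple graph $G$, a set $S \subseteq V(G)$ is a decycling set of $G$ if the graph $G - S$ obtained by deleting the vertices of $S$ is acyclic (a forest). The decycling number $\nabla(G)$ is the minimum cardinality of a decycling set of $G$. $C_n$ denotes the cycle on $n$ vertices. For a graph $G$ and positive integer $m$, the $m$-th power $G^{m}$ is the simple graph with $V(G^m)=V(G)$ in which two distinct vertices $u,v$ are adjacent iff their distance in $G$ satisfies $d_G(u,v) \leq m$. -}

module Defs where

open import Data.Nat using (ℕ; zero; suc; _+_; _≤_; _/_)
open import Data.Fin using (Fin; toℕ)
open import Data.Fin.Subset using (Subset; _∉_)
open import Data.Vec using (Vec; lookup; head; last; _∷_; [])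
open import Data.Product using (Σ; ∃; _×_; _,_)
open import Data.Sum using (_⊎_)
open import Function.Definitions using (Injective)
open import Relation.Binary.PropositionalEquality using (_≡_)
open import Relation.Nullary using (¬_)
open import Data.Empty using (⊥)

record Graph (n : ℕ) : Set₁ where
  field
    Adj : Fin n → Fin n → Set
open Graph public

data Walk {n : ℕ} (G : Graph n) : ℕ → Fin n → Fin n → Set where
  here : ∀ {u} → Walk G 0 u u
  step : ∀ {k u v w} → Adj G u v → Walk G k v w → Walk G (suc k) u w

DistLe : ∀ {n} → Graph n → Fin n → Fin n → ℕ → Set
DistLe G u v m = ∃ λ k → k ≤ m × Walk G k u v

_^^_ : ∀ {n} → Graph n → ℕ → Graph n
Adj (G ^^ m) u v = ¬ (u ≡ v) × DistLe G u v m

C : (n : ℕ) → Graph n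
Adj (C n) u v =
  (suc (toℕ u) ≡ toℕ v) ⊎ (suc (toℕ v) ≡ toℕ u)
  ⊎ (toℕ u ≡ 0 × suc (toℕ v) ≡ n) ⊎ (toℕ v ≡ 0 × suc (toℕ u) ≡ n)

data Chain {n : ℕ} (G : Graph n) : ∀ {k} → Vec (Fin n) (suc k) → Set where
  one  : ∀ {v} → Chain G (v ∷ [])
  cons : ∀ {k u v} {vs : Vec (Fin n) k} →
         Adj G u v → Chain G (v ∷ vs) → Chain G (u ∷ v ∷ vs)

record Cycle {n : ℕ} (G : Graph n) (k : ℕ) (vs : Vec (Fin n) (suc (suc (suc k)))) : Set where
  field
    distinct : Injective _≡_ _≡_ (lookup vs)
    chain    : Chain G vs
    closing  : Adj G (last vs) (head vs)

DecyclingSet : ∀ {n} → Graph n → Subset n → Set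
DecyclingSet {n} G S =
  ∀ k (vs : Vec (Fin n) (suc (suc (suc k)))) →
  Cycle G k vs → (∀ i → lookup vs i ∉ S) → ⊥

⌈_/3⌉ : ℕ → ℕ
⌈ a /3⌉ = (a + 2) / 3

-- Three consecutive vertices of C_n² form a triangle, so a decycling set S meets every window
-- of three consecutive vertices. Counting around the cycle from a vertex of S then gives
-- |S| ≥ 1 + ⌊(n - 1)/3⌋, which is enough for n = 4, and counting from two consecutive vertices
-- of S gives |S| ≥ 2 + ⌊(n - 2)/3⌋ ≥ ⌈(n + 1)/3⌉. When n ≥ 5 and S contains no two consecutive
-- vertices, consecutive vertices outside S are at most two apart, so together they form a cycle
-- of C_n² avoiding S, which is impossible.

module Submission where

open import Defs
open import Data.Nat using (ℕ; _≤_; _+_)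
open import Data.Fin.Subset using (Subset; ∣_∣)

open import Data.Nat.Base using (zero; suc; _<_; _*_; _∸_; z≤n; s≤s; s≤s⁻¹; NonZero; >-nonZero; _/_; _%_)
open import Data.Nat.Properties
open import Data.Nat.DivMod using (_mod_; m≡m%n+[m/n]*n; m/n*n≤m; m%n<n; m<n⇒m%n≡m; n%n≡0; [m+n]%n≡m%n; [m+kn]%n≡m%n; m/n≡1+[m∸n]/n; /-monoˡ-≤)
open import Data.Fin.Base using (Fin; toℕ)
open import Data.Fin.Properties using (toℕ-injective; toℕ-fromℕ<; toℕ<n)
open import Data.Fin.Subset using (_∉_)
open import Data.Vec.Base using (Vec; []; _∷_; lookup; head; last)
open import Data.Vec.Properties using ([]=⇒lookup)
open import Data.Bool.Base using (Bool; true; false; _∨_)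
open import Data.Bool.Properties using (¬-not) renaming (_≟_ to _≟ᵇ_)
open import Data.Product using (∃; _×_; _,_)
open import Data.Sum using (_⊎_; inj₁; inj₂)
open import Data.Empty using (⊥; ⊥-elim)
open import Function.Base using (_∘_)
open import Function.Definitions using (Injective)
open import Relation.Binary.PropositionalEquality
open import Relation.Nullary using (¬_; Dec; yes; no)
open import Relation.Nullary.Decidable using (_×-dec_)

bit : Bool → ℕ
bit true  = 1
bit false = 0

count : (ℕ → Bool) → ℕ → ℕ
count h zero    = 0
count h (suc L) = bit (h 0) + count (h ∘ suc) L

count-+ : ∀ h a b → count h (a + b) ≡ count h a + count (λ i → h (a + i)) b
count-+ h zero    b = refl
count-+ h (suc a) b = trans (cong (bit (h 0) +_) (count-+ (h ∘ suc) a b)) (sym (+-assoc (bit (h 0)) _ _))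

count-monoʳ : ∀ h {a b} → a ≤ b → count h a ≤ count h b
count-monoʳ h z≤n       = z≤n
count-monoʳ h (s≤s a≤b) = +-monoʳ-≤ (bit (h 0)) (count-monoʳ (h ∘ suc) a≤b)

count-lookup : ∀ {m} (v : Vec Bool m) h → (∀ i → h (toℕ i) ≡ lookup v i) → ∣ v ∣ ≡ count h m
count-lookup []      h _   = refl
count-lookup (x ∷ v) h h≡v rewrite h≡v Fin.zero with x
... | true  = cong suc (count-lookup v (h ∘ suc) (h≡v ∘ Fin.suc))
... | false = count-lookup v (h ∘ suc) (h≡v ∘ Fin.suc)

Periodic : ℕ → (ℕ → Bool) → Set
Periodic n h = ∀ i → h (i + n) ≡ h i

count-snoc : ∀ h L → count h (suc L) ≡ count h L + bit (h L)
count-snoc h zero    = +-identityʳ (bit (h 0))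
count-snoc h (suc L) = trans (cong (bit (h 0) +_) (count-snoc (h ∘ suc) L)) (sym (+-assoc (bit (h 0)) _ _))

count-shift : ∀ {n} h → Periodic n h → count (h ∘ suc) n ≡ count h n
count-shift {n} h per = +-cancelˡ-≡ (bit (h 0)) _ _ (begin
  count h (suc n)        ≡⟨ count-snoc h n ⟩
  count h n + bit (h n)  ≡⟨ cong (λ b → count h n + bit b) (per 0) ⟩
  count h n + bit (h 0)  ≡⟨ +-comm (count h n) _ ⟩
  bit (h 0) + count h n  ∎)
  where open ≡-Reasoning

count-rotate : ∀ {n} h → Periodic n h → ∀ a → count (λ i → h (a + i)) n ≡ count h n
count-rotate h per zero    = refl
count-rotate h per (suc a) = trans (count-rotate (h ∘ suc) (per ∘ suc) a) (count-shift h per)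

Covering : (ℕ → Bool) → Set
Covering h = ∀ i → (h i ∨ h (suc i) ∨ h (suc (suc i))) ≡ true

covering-shift : ∀ h → Covering h → ∀ c → Covering (λ i → h (c + i))
covering-shift h cov c i rewrite +-suc c (suc i) | +-suc c i = cov (c + i)

covering⇒∃true : ∀ {h} → Covering h → ∃ λ p → h p ≡ true
covering⇒∃true {h} cov with h 0 in e₀ | h 1 in e₁ | cov 0
... | true  | _    | _  = 0 , e₀
... | false | true | _  = 1 , e₁
... | false | false | e₂ = 2 , e₂

1≤count-window : ∀ h → Covering h → 1 ≤ count h 3
1≤count-window h cov = bits (h 0) (h 1) (h 2) (cov 0)
  where
  bits : ∀ a b c → (a ∨ b ∨ c) ≡ true → 1 ≤ bit a + (bit b + (bit c + 0))
  bits true  _     _    _  = s≤s z≤n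
  bits false true  _    _  = s≤s z≤n
  bits false false true _  = s≤s z≤n

count-covering-*3 : ∀ h → Covering h → ∀ q → q ≤ count h (q * 3)
count-covering-*3 h cov zero    = z≤n
count-covering-*3 h cov (suc q) = begin
  1 + q                                           ≤⟨ +-mono-≤ (1≤count-window h cov) (count-covering-*3 _ (cov ∘ (3 +_)) q) ⟩
  count h 3 + count (λ i → h (3 + i)) (q * 3)    ≡⟨ count-+ h 3 (q * 3) ⟨
  count h (3 + q * 3)                             ∎
  where open ≤-Reasoning

count-covering : ∀ h → Covering h → ∀ L → L / 3 ≤ count h L
count-covering h cov L = ≤-trans (count-covering-*3 h cov (L / 3)) (count-monoʳ h (m/n*n≤m L 3))

%≡%∧<⇒+≤ : ∀ {m o} n .{{_ : NonZero n}} → m % n ≡ o % n → m < o → m + n ≤ o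
%≡%∧<⇒+≤ {m} {o} n m%n≡o%n m<o = begin
  m + n                     ≡⟨ cong (_+ n) m≡ ⟩
  r + m / n * n + n         ≡⟨ +-assoc r _ n ⟩
  r + (m / n * n + n)       ≡⟨ cong (r +_) (+-comm _ n) ⟩
  r + suc (m / n) * n       ≤⟨ +-monoʳ-≤ r (*-monoˡ-≤ n m/n<o/n) ⟩
  r + o / n * n             ≡⟨ o≡ ⟨
  o                         ∎
  where
  open ≤-Reasoning
  r : ℕ
  r = m % n
  m≡ : m ≡ r + m / n * n
  m≡ = m≡m%n+[m/n]*n m n
  o≡ : o ≡ r + o / n * n
  o≡ = trans (m≡m%n+[m/n]*n o n) (cong (_+ o / n * n) (sym m%n≡o%n))
  m/n<o/n : m / n < o / n
  m/n<o/n = ≰⇒> λ o/n≤m/n → <⇒≱ m<o (begin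
    o              ≡⟨ o≡ ⟩
    r + o / n * n  ≤⟨ +-monoʳ-≤ r (*-monoˡ-≤ n o/n≤m/n) ⟩
    r + m / n * n  ≡⟨ m≡ ⟨
    m              ∎)

⌈n+1/3⌉≤2+[n∸2]/3 : ∀ n → ⌈ n + 1 /3⌉ ≤ 2 + (n ∸ 2) / 3
⌈n+1/3⌉≤2+[n∸2]/3 zero          = s≤s z≤n
⌈n+1/3⌉≤2+[n∸2]/3 (suc zero)    = s≤s z≤n
⌈n+1/3⌉≤2+[n∸2]/3 n@(suc (suc m)) = begin
  (n + 1 + 2) / 3  ≤⟨ /-monoˡ-≤ 3 n+3≤4+n ⟩
  (6 + m) / 3      ≡⟨ m/n≡1+[m∸n]/n {6 + m} (m≤m+n 3 (3 + m)) ⟩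
  1 + (3 + m) / 3  ≡⟨ cong suc (m/n≡1+[m∸n]/n {3 + m} (m≤m+n 3 m)) ⟩
  2 + m / 3        ∎
  where
  open ≤-Reasoning
  n+3≤4+n : n + 1 + 2 ≤ 4 + n
  n+3≤4+n = ≤-trans (≤-reflexive (trans (+-assoc n 1 2) (+-comm n 3))) (n≤1+n (3 + n))

no-closed-chain : ∀ {n} {G : Graph n} {S} → DecyclingSet G S →
                  ∀ {m} (vs : Vec (Fin n) (suc m)) → 2 ≤ m → Injective _≡_ _≡_ (lookup vs) →
                  Chain G vs → Adj G (last vs) (head vs) → ¬ (∀ i → lookup vs i ∉ S)
no-closed-chain D {suc zero}    vs (s≤s ())
no-closed-chain D {suc (suc k)} vs _         inj chain closing =
  D k vs (record { distinct = inj ; chain = chain ; closing = closing })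

data Hop (a : ℕ) : ℕ → Set where
  hop₁ : Hop a (1 + a)
  hop₂ : Hop a (2 + a)

hop-< : ∀ {a b} → Hop a b → a < b
hop-< hop₁ = n<1+n _
hop-< hop₂ = m<n⇒m<1+n (n<1+n _)

hop-≤ : ∀ {a b} → Hop a b → b ≤ 2 + a
hop-≤ hop₁ = n≤1+n _
hop-≤ hop₂ = ≤-refl

module CycleSquare (n : ℕ) (3≤n : 3 ≤ n) where

  instance
    n-nonZero : NonZero n
    n-nonZero = >-nonZero (≤-trans (s≤s z≤n) 3≤n)

  C² : Graph n
  C² = C n ^^ 2

  -- Vertices are addressed by naturals read modulo n, so that windows and rotations of the
  -- cycle can be handled on ℕ.
  ⟦_⟧ : ℕ → Fin n
  ⟦ x ⟧ = x mod n

  toℕ-⟦⟧ : ∀ x → toℕ ⟦ x ⟧ ≡ x % n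
  toℕ-⟦⟧ x = toℕ-fromℕ< (m%n<n x n)

  ⟦toℕ⟧ : ∀ i → ⟦ toℕ i ⟧ ≡ i
  ⟦toℕ⟧ i = toℕ-injective (trans (toℕ-⟦⟧ (toℕ i)) (m<n⇒m%n≡m (toℕ<n i)))

  ⟦+n⟧ : ∀ x → ⟦ x + n ⟧ ≡ ⟦ x ⟧
  ⟦+n⟧ x = toℕ-injective (trans (toℕ-⟦⟧ (x + n)) (trans ([m+n]%n≡m%n x n) (sym (toℕ-⟦⟧ x))))

  ⟦⟧-injective-within : ∀ {u v} → u < v → v < u + n → ⟦ u ⟧ ≢ ⟦ v ⟧
  ⟦⟧-injective-within {u} {v} u<v v<u+n ⟦u⟧≡⟦v⟧ = <⇒≱ v<u+n (%≡%∧<⇒+≤ n u%n≡v%n u<v)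
    where
    u%n≡v%n : u % n ≡ v % n
    u%n≡v%n = trans (sym (toℕ-⟦⟧ u)) (trans (cong toℕ ⟦u⟧≡⟦v⟧) (toℕ-⟦⟧ v))

  [1+m]%n≡[1+m%n]%n : ∀ x → suc x % n ≡ suc (x % n) % n
  [1+m]%n≡[1+m%n]%n x = trans (cong (λ y → suc y % n) (m≡m%n+[m/n]*n x n)) ([m+kn]%n≡m%n (suc (x % n)) (x / n) n)

  C-adj-suc : ∀ x → Adj (C n) ⟦ x ⟧ ⟦ suc x ⟧
  C-adj-suc x rewrite toℕ-⟦⟧ x | toℕ-⟦⟧ (suc x) | [1+m]%n≡[1+m%n]%n x with m≤n⇒m<n∨m≡n (m%n<n x n)
  ... | inj₁ 1+r<n = inj₁ (sym (m<n⇒m%n≡m 1+r<n))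
  ... | inj₂ 1+r≡n = inj₂ (inj₂ (inj₂ (trans (cong (_% n) 1+r≡n) (n%n≡0 n) , 1+r≡n)))

  C-adj-sym : ∀ {u v} → Adj (C n) u v → Adj (C n) v u
  C-adj-sym (inj₁ e)               = inj₂ (inj₁ e)
  C-adj-sym (inj₂ (inj₁ e))        = inj₁ e
  C-adj-sym (inj₂ (inj₂ (inj₁ e))) = inj₂ (inj₂ (inj₂ e))
  C-adj-sym (inj₂ (inj₂ (inj₂ e))) = inj₂ (inj₂ (inj₁ e))

  3+a≤a+n : ∀ a → 3 + a ≤ a + n
  3+a≤a+n a = subst (3 + a ≤_) (+-comm n a) (+-monoˡ-≤ a 3≤n)

  hop-distinct : ∀ {a b} → Hop a b → ⟦ a ⟧ ≢ ⟦ b ⟧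
  hop-distinct {a} h = ⟦⟧-injective-within (hop-< h) (≤-trans (s≤s (hop-≤ h)) (3+a≤a+n a))

  hop-adj : ∀ {a b} → Hop a b → Adj C² ⟦ a ⟧ ⟦ b ⟧
  hop-adj {a} h@hop₁ = hop-distinct h , 1 , s≤s z≤n , step (C-adj-suc a) here
  hop-adj {a} h@hop₂ = hop-distinct h , 2 , ≤-refl , step (C-adj-suc a) (step (C-adj-suc (suc a)) here)

  hop-adj⁻¹ : ∀ {a b} → Hop a b → Adj C² ⟦ b ⟧ ⟦ a ⟧
  hop-adj⁻¹ {a} h@hop₁ = hop-distinct h ∘ sym , 1 , s≤s z≤n , step (C-adj-sym (C-adj-suc a)) here
  hop-adj⁻¹ {a} h@hop₂ = hop-distinct h ∘ sym , 2 , ≤-refl ,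
    step (C-adj-sym (C-adj-suc (suc a))) (step (C-adj-sym (C-adj-suc a)) here)

  hop-closing : ∀ {a c} → Hop c (a + n) → Adj C² ⟦ c ⟧ ⟦ a ⟧
  hop-closing {a} h = subst (Adj C² _) (⟦+n⟧ a) (hop-adj h)

module Decycling (n : ℕ) (3≤n : 3 ≤ n) (S : Subset n) (D : DecyclingSet (C n ^^ 2) S) where

  open CycleSquare n 3≤n

  g : ℕ → Bool
  g x = lookup S ⟦ x ⟧

  g-periodic : Periodic n g
  g-periodic x = cong (lookup S) (⟦+n⟧ x)

  ∣S∣≡count : ∣ S ∣ ≡ count g n
  ∣S∣≡count = count-lookup S g (cong (lookup S) ∘ ⟦toℕ⟧)

  ∉S : ∀ {x} → g x ≡ false → ⟦ x ⟧ ∉ S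
  ∉S gx≡false x∈S with trans (sym ([]=⇒lookup x∈S)) gx≡false
  ... | ()

  -- A path a < ⋯ < c of C_n² through positions outside S, each step of length 1 or 2.
  data Run : ℕ → ℕ → Set where
    stop : ∀ {a} → g a ≡ false → Run a a
    cons : ∀ {a b c} → g a ≡ false → Hop a b → Run b c → Run a c

  hops : ∀ {a c} → Run a c → ℕ
  hops (stop _)     = 0
  hops (cons _ _ r) = suc (hops r)

  run-start : ∀ {a c} → Run a c → g a ≡ false
  run-start (stop ga)     = ga
  run-start (cons ga _ _) = ga

  run-≤ : ∀ {a c} → Run a c → a ≤ c
  run-≤ (stop _)     = ≤-refl
  run-≤ (cons _ h r) = ≤-trans (<⇒≤ (hop-< h)) (run-≤ r)

  run-long : ∀ {a c} (r : Run a c) → 2 + a < c → 2 ≤ hops r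
  run-long (stop _)                 a+2<a = ⊥-elim (<⇒≱ a+2<a (m≤n+m _ 2))
  run-long (cons _ h (stop _))      a+2<b = ⊥-elim (<⇒≱ a+2<b (hop-≤ h))
  run-long (cons _ _ (cons _ _ _))  _     = s≤s (s≤s z≤n)

  vertices : ∀ {a c} (r : Run a c) → Vec (Fin n) (suc (hops r))
  later    : ∀ {a c} (r : Run a c) → Vec (Fin n) (hops r)
  vertices {a} r = ⟦ a ⟧ ∷ later r
  later (stop _)     = []
  later (cons _ _ r) = vertices r

  vertices-chain : ∀ {a c} (r : Run a c) → Chain C² (vertices r)
  vertices-chain (stop _)     = one
  vertices-chain (cons _ h r) = cons (hop-adj h) (vertices-chain r)

  last-vertices : ∀ {a c} (r : Run a c) → last (vertices r) ≡ ⟦ c ⟧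
  last-vertices (stop _)     = refl
  last-vertices (cons _ _ r) = last-vertices r

  vertices-∉S : ∀ {a c} (r : Run a c) i → lookup (vertices r) i ∉ S
  vertices-∉S r            Fin.zero    = ∉S (run-start r)
  vertices-∉S (cons _ _ r) (Fin.suc i) = vertices-∉S r i

  later-in-run : ∀ {a c} (r : Run a c) i → ∃ λ v → lookup (later r) i ≡ ⟦ v ⟧ × a < v × v ≤ c
  later-in-run (cons {b = b} _ h r) Fin.zero    = b , refl , hop-< h , run-≤ r
  later-in-run (cons         _ h r) (Fin.suc i) with later-in-run r i
  ... | v , eq , b<v , v≤c = v , eq , <-trans (hop-< h) b<v , v≤c

  head≢later : ∀ {a c} (r : Run a c) → c < a + n → ∀ i → ⟦ a ⟧ ≢ lookup (later r) i
  head≢later r c<a+n i ⟦a⟧≡ with later-in-run r i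
  ... | v , eq , a<v , v≤c = ⟦⟧-injective-within a<v (≤-<-trans v≤c c<a+n) (trans ⟦a⟧≡ eq)

  vertices-injective : ∀ {a c} (r : Run a c) → c < a + n → Injective _≡_ _≡_ (lookup (vertices r))
  vertices-injective r            _     {Fin.zero}  {Fin.zero}  _  = refl
  vertices-injective r            c<a+n {Fin.zero}  {Fin.suc j} eq = ⊥-elim (head≢later r c<a+n j eq)
  vertices-injective r            c<a+n {Fin.suc i} {Fin.zero}  eq = ⊥-elim (head≢later r c<a+n i (sym eq))
  vertices-injective (cons _ h r) c<a+n {Fin.suc i} {Fin.suc j} eq =
    cong Fin.suc (vertices-injective r (<-≤-trans c<a+n (+-monoˡ-≤ n (<⇒≤ (hop-< h)))) eq)

  run-cycle : ∀ {a c} (r : Run a c) → 2 ≤ hops r → c < a + n → Adj C² ⟦ c ⟧ ⟦ a ⟧ → ⊥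
  run-cycle {a} r 2≤hops c<a+n closing =
    no-closed-chain D (vertices r) 2≤hops (vertices-injective r c<a+n) (vertices-chain r)
      (subst (λ v → Adj C² v ⟦ a ⟧) (sym (last-vertices r)) closing) (vertices-∉S r)

  run-around : ∀ {a c} → Run a c → 2 + a < c → Hop c (a + n) → ⊥
  run-around r long h = run-cycle r (run-long r long) (hop-< h) (hop-closing h)

  g-covering : Covering g
  -- Three consecutive vertices span a triangle of C_n².
  g-covering x with g x in e₀ | g (suc x) in e₁ | g (suc (suc x)) in e₂
  ... | true  | _     | _     = refl
  ... | false | true  | _     = refl
  ... | false | false | true  = refl
  ... | false | false | false =
    ⊥-elim (run-cycle (cons e₀ hop₁ (cons e₁ hop₁ (stop e₂))) ≤-refl (3+a≤a+n x) (hop-adj⁻¹ hop₂))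

  rotated-bound : ∀ p k → k ≤ n → count (λ i → g (p + i)) k + (n ∸ k) / 3 ≤ ∣ S ∣
  rotated-bound p k k≤n = begin
    count f k + (n ∸ k) / 3                      ≤⟨ +-monoʳ-≤ (count f k) (count-covering _ tail-covering (n ∸ k)) ⟩
    count f k + count (λ i → f (k + i)) (n ∸ k)  ≡⟨ count-+ f k (n ∸ k) ⟨
    count f (k + (n ∸ k))                        ≡⟨ cong (count f) (m+[n∸m]≡n k≤n) ⟩
    count f n                                    ≡⟨ count-rotate g g-periodic p ⟩
    count g n                                    ≡⟨ ∣S∣≡count ⟨
    ∣ S ∣                                        ∎
    where
    open ≤-Reasoning
    f : ℕ → Bool
    f i = g (p + i)
    tail-covering : Covering (λ i → f (k + i))
    tail-covering = covering-shift f (covering-shift g g-covering p) k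

  member-bound : 1 + (n ∸ 1) / 3 ≤ ∣ S ∣
  member-bound with covering⇒∃true g-covering
  ... | p , gp = subst (λ x → x + (n ∸ 1) / 3 ≤ ∣ S ∣) count≡1 (rotated-bound p 1 (≤-trans (s≤s z≤n) 3≤n))
    where
    count≡1 : count (λ i → g (p + i)) 1 ≡ 1
    count≡1 = cong (λ b → bit b + 0) (trans (cong g (+-identityʳ p)) gp)

  Pair : ℕ → Set
  Pair p = g p ≡ true × g (suc p) ≡ true

  pair? : ∀ p → Dec (Pair p)
  pair? p = (g p ≟ᵇ true) ×-dec (g (suc p) ≟ᵇ true)

  pair-bound : ∀ {p} → Pair p → 2 + (n ∸ 2) / 3 ≤ ∣ S ∣
  pair-bound {p} (gp , gsp) = subst (λ x → x + (n ∸ 2) / 3 ≤ ∣ S ∣) count≡2 (rotated-bound p 2 (≤-trans (s≤s (s≤s z≤n)) 3≤n))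
    where
    count≡2 : count (λ i → g (p + i)) 2 ≡ 2
    count≡2 = cong₂ (λ b b′ → bit b + (bit b′ + 0)) (trans (cong g (+-identityʳ p)) gp) (trans (cong g (+-comm p 1)) gsp)

  module NoPair (5≤n : 5 ≤ n) (no-pair : ¬ (∃ λ p → p < n × Pair p)) where

    0<n : 0 < n
    0<n = ≤-trans (s≤s z≤n) 5≤n

    after-member : ∀ {p} → p < n → g p ≡ true → g (suc p) ≡ false
    after-member {p} p<n gp = ¬-not λ gsp → no-pair (p , p<n , gp , gsp)

    End : ℕ → Set
    End b = suc b ≡ n ⊎ (2 + b ≡ n × g (suc b) ≡ true)

    Reach : ℕ → Set
    Reach a = ∃ λ b → Run a b × End b

    prepend : ∀ {a b} → g a ≡ false → Hop a b → Reach b → Reach a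
    prepend ga h (c , r , end) = c , cons ga h r , end

    run-to-end : ∀ d a → suc a + d ≡ n → g a ≡ false → Reach a
    run-to-end zero a e ga = a , stop ga , inj₁ (trans (sym (+-identityʳ _)) e)
    run-to-end (suc d) a e ga with g (suc a) in gsa
    ... | false = prepend ga hop₁ (run-to-end d (suc a) (trans (sym (+-suc (suc a) d)) e) gsa)
    run-to-end (suc zero) a e ga | true = a , stop ga , inj₂ (trans (+-comm 1 (suc a)) e , gsa)
    run-to-end (suc (suc d)) a e ga | true =
      prepend ga hop₂ (run-to-end d (2 + a) (trans (sym (+-suc (2 + a) d)) e′) (after-member sa<n gsa))
      where
      e′ : 2 + a + suc d ≡ n
      e′ = trans (sym (+-suc (suc a) (suc d))) e
      sa<n : suc a < n
      sa<n = ≤-trans (m≤m+n (2 + a) (suc d)) (≤-reflexive e′)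

    end-hop : ∀ {b} → End b → Hop b n
    end-hop (inj₁ e)       = subst (Hop _) e hop₁
    end-hop (inj₂ (e , _)) = subst (Hop _) e hop₂

    end-≥3 : ∀ {b} → End b → 3 ≤ b
    end-≥3 (inj₁ e)       = ≤-trans (n≤1+n 3) (s≤s⁻¹ (subst (5 ≤_) (sym e) 5≤n))
    end-≥3 (inj₂ (e , _)) = s≤s⁻¹ (s≤s⁻¹ (subst (5 ≤_) (sym e) 5≤n))

    no-pair-contradiction : ⊥
    no-pair-contradiction with g 0 in g0
    ... | false with run-to-end (n ∸ 1) 0 (m+[n∸m]≡n 0<n) g0
    ...   | b , r , end = run-around r (end-≥3 end) (end-hop end)
    no-pair-contradiction | true
      with run-to-end (n ∸ 2) 1 (m+[n∸m]≡n (≤-trans (s≤s (s≤s z≤n)) 5≤n)) (after-member 0<n g0)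
    ... | b , r , inj₁ 1+b≡n =
      run-around r (s≤s⁻¹ (subst (5 ≤_) (sym 1+b≡n) 5≤n)) (subst (Hop b) (cong suc 1+b≡n) hop₂)
    ... | b , r , inj₂ (2+b≡n , g1+b) =
      no-pair (suc b , ≤-reflexive 2+b≡n , g1+b , trans (cong g 2+b≡n) (trans (g-periodic 0) g0))

corollary2 : (n : ℕ) → 4 ≤ n → (S : Subset n) →
    DecyclingSet (C n ^^ 2) S → ⌈ n + 1 /3⌉ ≤ ∣ S ∣
corollary2 n 4≤n S D with m≤n⇒m<n∨m≡n 4≤n
... | inj₂ refl = member-bound
  where open Decycling 4 (n≤1+n 3) S D
... | inj₁ 5≤n = by-pair (anyUpTo? pair? n)
  where
  open Decycling n (≤-trans (n≤1+n 3) 4≤n) S D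
  by-pair : Dec (∃ λ p → p < n × Pair p) → ⌈ n + 1 /3⌉ ≤ ∣ S ∣
  by-pair (yes (_ , _ , pair)) = ≤-trans (⌈n+1/3⌉≤2+[n∸2]/3 n) (pair-bound pair)
  by-pair (no no-pair)         = ⊥-elim (NoPair.no-pair-contradiction 5≤n no-pair)
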